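{- Let $\mathrm{sort}$ be a sort function satisfying the characteristic property. Then $\mathrm{sort}$ is parametric: for all types $T_1,T_2$ and every relation $\sim_T \subseteq T_1 \times T_2$, all $\leq_1 : T_1 \to T_1 \to \mathrm{bool}$ and $\leq_2 : T_2 \to T_2 \to \mathrm{bool}$ such that $x_1 \sim_T x_2$ and $y_1 \sim_T y_2$ imply $(x_1 \leq_1 y_1) = (x_2 \leq_2 y_2)$, and all lists $xs_1 : \mathrm{list}\,T_1$, $xs_2 : \mathrm{list}\,T_2$ of equal length that are pointwise $\sim_T$-related, the lists $\mathrm{sort}_{\leq_1}\,xs_1$ and $\mathrm{sort}_{\leq_2}\,xs_2$ have equal length and are pointwise $\sim_T$-related.
   Context: Lists: $[]$ is the empty list, $x :: s$ is cons, $[x]$ is the singleton list, $\mathbin{+\!\!+}$ is concatenation. A "relation" $\leq$ on a type $T$ is a function $T \to T \to \mathrm{bool}$. The merge of two lists w.r.t. $\leq$ is defined by $[] \mathbin{\land\hspace{ -.45em}\land}_\leq ys = ys$, $xs \mathbin{\land\hspace{ -.45em}\land}_\leq [] = xs$, and $(x :: xs) \mathbin{\land\hspace{ -.45em}\land}_\leq (y :: ys) = x :: (xs \mathbin{\land\hspace{ -.45em}\land}_\leq (y :: ys))$ if $x \leq y$, and $= y :: ((x :: xs) \mathbin{\land\hspace{ -.45em}\land}_\leq ys)$ otherwise. A sort function $\mathrm{sort}$ assigns to every type $T$ and relation $\leq$ on $T$ a function $\mathrm{sort}_\leq : \mathrm{list}\,T \to \mathrm{list}\,T$. It satisfies the characteristic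 property if there is a polymorphic function $\mathrm{asort}$ of type $\forall (T\,R : \mathcal{U}), (R \to R \to R) \to (T \to R) \to R \to \mathrm{list}\,T \to R$ such that: (1) for all $T$, $\leq$, $xs$: $\mathrm{asort}\,(\mathbin{\land\hspace{ -.45em}\land}_\leq)\,(\lambda x.[x])\,[]\,xs = \mathrm{sort}_\leq\,xs$; (2) for all $T$, $xs$: $\mathrm{asort}\,(\mathbin{+\!\!+})\,(\lambda x.[x])\,[]\,xs = xs$; (3) $\mathrm{asort}$ is relationally parametric: for all types $T_1,T_2$ and relation $\sim_T \subseteq T_1 \times T_2$, all types $R_1,R_2$ and relation $\sim_R \subseteq R_1\times R_2$, all $m_i : R_i \to R_i \to R_i$ with $a_1 \sim_R a_2 \wedge b_1 \sim_R b_2 \Rightarrow m_1\,a_1\,b_1 \sim_R m_2\,a_2\,b_2$, all $s_i : T_i \to R_i$ with $x_1 \sim_T x_2 \Rightarrow s_1\,x_1 \sim_R s_2\,x_2$, all $e_i : R_i$ with $e_1 \sim_R e_2$, and all lists $xs_1 : \mathrm{list}\,T_1$, $xs_2 : \mathrm{list}\,T_2$ of equal length that are pointwise $\sim_T$-related, we have $\mathrm{asort}\,m_1\,s_1\,e_1\,xs_1 \sim_R \mathrm{asort}\,m_2\,s_2\,e_2\,xs_2$. -}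

module Defs where

open import Data.Bool using (Bool; true; false; if_then_else_)
open import Data.List using (List; []; _∷_; [_]; _++_)
open import Data.List.Relation.Binary.Pointwise using (Pointwise)
open import Data.Product using (Σ; _×_)
open import Relation.Binary.PropositionalEquality using (_≡_)

-- merge of two lists w.r.t. a boolean relation (as in the paper);
-- defined with an auxiliary function for structural termination
merge : {T : Set} → (T → T → Bool) → List T → List T → List T
merge {T} leq [] ys = ys
merge {T} leq (x ∷ xs) ys = go ys
  where
  go : List T → List T
  go [] = x ∷ xs
  go (y ∷ ys') = if leq x y then x ∷ merge leq xs (y ∷ ys') else y ∷ go ys'

SortFn : Set₁
SortFn = {T : Set} → (T → T → Bool) → List T → List T

ASortTy : Set₁
ASortTy = {T R : Set} → (R → R → R) → (T → R) → R → List T → R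

ASortParametric : ASortTy → Set₁
ASortParametric asort =
  {T₁ T₂ : Set} (_~T_ : T₁ → T₂ → Set)
  {R₁ R₂ : Set} (_~R_ : R₁ → R₂ → Set)
  (m₁ : R₁ → R₁ → R₁) (m₂ : R₂ → R₂ → R₂) →
  (∀ {a₁ a₂ b₁ b₂} → a₁ ~R a₂ → b₁ ~R b₂ → m₁ a₁ b₁ ~R m₂ a₂ b₂) →
  (s₁ : T₁ → R₁) (s₂ : T₂ → R₂) →
  (∀ {x₁ x₂} → x₁ ~T x₂ → s₁ x₁ ~R s₂ x₂) →
  (e₁ : R₁) (e₂ : R₂) → e₁ ~R e₂ →
  (xs₁ : List T₁) (xs₂ : List T₂) → Pointwise _~T_ xs₁ xs₂ →
  asort m₁ s₁ e₁ xs₁ ~R asort m₂ s₂ e₂ xs₂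

CharacteristicProperty : SortFn → Set₁
CharacteristicProperty sort =
  Σ ASortTy λ asort →
    ((T : Set) (leq : T → T → Bool) (xs : List T) →
       asort (merge leq) [_] [] xs ≡ sort leq xs)
  × ((T : Set) (xs : List T) → asort _++_ [_] [] xs ≡ xs)
  × ASortParametric asort

SortParametric : SortFn → Set₁
SortParametric sort =
  {T₁ T₂ : Set} (_~T_ : T₁ → T₂ → Set)
  (leq₁ : T₁ → T₁ → Bool) (leq₂ : T₂ → T₂ → Bool) →
  (∀ {x₁ x₂ y₁ y₂} → x₁ ~T x₂ → y₁ ~T y₂ → leq₁ x₁ y₁ ≡ leq₂ x₂ y₂) →
  (xs₁ : List T₁) (xs₂ : List T₂) → Pointwise _~T_ xs₁ xs₂ →
  Pointwise _~T_ (sort leq₁ xs₁) (sort leq₂ xs₂)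

-- Instantiate the parametricity of asort with the relation "pointwise ~"
-- on result lists: singletons and [] are related, and merging two pairs of
-- related lists yields related lists because the comparisons agree at every
-- step. The first clause of the characteristic property then identifies
-- both sides with sort.
module Submission where

open import Defs
open import Data.Bool using (Bool; true; false; if_then_else_)
open import Data.List using (List; []; _∷_; [_])
open import Data.List.Relation.Binary.Pointwise using (Pointwise; []; _∷_)
open import Data.Product using (_,_)
open import Relation.Binary.PropositionalEquality using (_≡_; refl; subst₂)

module _ {A₁ A₂ : Set} (_~_ : A₁ → A₂ → Set) where

  if-pointwise : ∀ {b₁ b₂ xs₁ xs₂ ys₁ ys₂} → b₁ ≡ b₂ →
                 Pointwise _~_ xs₁ xs₂ → Pointwise _~_ ys₁ ys₂ →
                 Pointwise _~_ (if b₁ then xs₁ else ys₁) (if b₂ then xs₂ else ys₂)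
  if-pointwise {true}  refl p q = p
  if-pointwise {false} refl p q = q

  merge-pointwise : {leq₁ : A₁ → A₁ → Bool} {leq₂ : A₂ → A₂ → Bool} →
                    (∀ {x₁ x₂ y₁ y₂} → x₁ ~ x₂ → y₁ ~ y₂ → leq₁ x₁ y₁ ≡ leq₂ x₂ y₂) →
                    ∀ {xs₁ xs₂ ys₁ ys₂} →
                    Pointwise _~_ xs₁ xs₂ → Pointwise _~_ ys₁ ys₂ →
                    Pointwise _~_ (merge leq₁ xs₁ ys₁) (merge leq₂ xs₂ ys₂)
  merge-pointwise leq≡ []       q        = q
  merge-pointwise leq≡ (p ∷ ps) []       = p ∷ ps
  merge-pointwise leq≡ (p ∷ ps) (q ∷ qs) =
    if-pointwise (leq≡ p q)
      (p ∷ merge-pointwise leq≡ ps (q ∷ qs))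
      (q ∷ merge-pointwise leq≡ (p ∷ ps) qs)

lemma3p13 : (sort : SortFn) → CharacteristicProperty sort → SortParametric sort
lemma3p13 sort (asort , asort-merge≡sort , _ , asort-parametric)
          _~_ leq₁ leq₂ leq≡ xs₁ xs₂ xs₁~xs₂ =
  subst₂ (Pointwise _~_) (asort-merge≡sort _ leq₁ xs₁) (asort-merge≡sort _ leq₂ xs₂)
    (asort-parametric _~_ (Pointwise _~_) (merge leq₁) (merge leq₂)
       (merge-pointwise _~_ leq≡)
       [_] [_] (λ x₁~x₂ → x₁~x₂ ∷ [])
       [] [] []
       xs₁ xs₂ xs₁~xs₂)
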